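{- Let $(G,\pi)$ be a parity game, $\tau$ a strategy for Odd, $T$ an $(n,d/2)$-universal tree with $h=d/2$, and $\mathcal{C}$ a cover of $\mathcal{T}$. For every arc $vw$ of the auxiliary digraph $D$ and every $0\le k<|\mathcal{C}_{\pi(w)/2}|$, we have $\underline{c}^k(vw)\le\overline{c}^k(vw)$.
   Context: A parity game: finite directed graph $G=(V,E)$, every node with an outgoing arc, $V=V_0\sqcup V_1$, priorities $\pi:V\to\{1,\dots,d\}$, $d$ even. A strategy for Odd is $\tau:V_1\to V$ with $v\tau(v)\in E$; $G_\tau=(V,E_\tau)$ with $E_\tau=\{vw\in E:v\in V_0\}\cup\{v\tau(v):v\in V_1\}$. An Even strategy $\sigma:V_0\to V$ gives $G_\sigma$ (all arcs out of $V_1$, only $v\sigma(v)$ out of $v\in V_0$). For a subgraph $H$: $\pi(H)$ max priority, $H$ even if $\pi(H)$ even, $\Pi(H)$ nodes of priority $\pi(H)$ ($v$ dominates $H$ if $v\in\Pi(H)$), $H_p$ induced subgraph on nodes of priority $\le p$, $N^+_H(v)$ out-neighbours. Ordered trees: prefix-closed sets of tuples over a linearly ordered set, viewed as rooted trees, ordered lexicographically; leaves of a height-$h$ tree are at depth $h$, written $\xi=(\xi_{2h-1},\dots,\xi_1)$; $\xi|_p$ deletes components with index $<p$; $L(T)$ leaves, $\bar L(T)=L(T)\cup\{\top\}$, $\top$ maximal, $\top|_p=\top$. $T\sqsubseteq T'$: injective edge-preserving order-preserving leaf-to-leaf map; $\equiv$ both ways; $\sqsubset$ strict. $(\ell,h)$-universal: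 height $h$, every height-$h$ tree with $\le\ell$ leaves at depth $h$ embeds. For a labeling $\nu$ into $\bar L(S)$ ($S$ an ordered tree): arc $vw$ non-violated if ($\pi(v)$ even and $\nu(v)|_{\pi(v)}\ge\nu(w)|_{\pi(v)}$) or ($\pi(v)$ odd and ($\nu(v)|_{\pi(v)}>\nu(w)|_{\pi(v)}$ or $\nu(v)=\nu(w)=\top$)); violated otherwise; tight if $\nu(v)$ is the smallest element of $\bar L(S)$ making $vw$ non-violated when substituted for $\nu(v)$; loose if neither. $\nu$ feasible in subgraph $H$: some Even strategy $\sigma$, with $v\sigma(v)\in E(H)$ whenever $v\in V_0$ has an outgoing arc in $H$, makes all arcs of $H$ in $G_\sigma$ non-violated; finite if no value $\top$. Base nodes $B(G_\tau)$: nodes in $\Pi(C)$ for some even cycle $C$ of $G_\tau$. Covers: $\mathcal{T}_j$ = pairwise non-equivalent subtrees of $T$ rooted at depth $h-j$; a cover $\mathcal{C}=(\mathcal{C}_0,\dots,\mathcal{C}_h)$ with $\mathcal{C}_j=(\mathcal{C}^0_j,\dots)$ chains of $(\mathcal{T}_j,\sqsubseteq)$ covering $\mathcal{T}_j$; chain $\mathcal{C}^k_j$: $T^k_{0,j}\sqsubset T^k_{1,j}\sqsubset\cdots$. Width: for a subgraph $H$ of $G_\tau$, $j=\lceil\pi(H)/2\rceil$, $\alpha^k(H)$ = least $i$ with a finite labeling $V(H)\to L(T^k_{i,j})$ feasible in $H$ ($\infty$ if none). Auxiliary digraph: for $w\in B(G_\tau)$, $K_w$ is the strongly connected component of $w$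 in $(G_\tau)_{\pi(w)}$; $K'_w$ is $K_w$ with all incoming arcs of nodes in $\Pi(K_w)\setminus\{w\}$ removed; $J_w$ is the subgraph of $K'_w$ induced by the nodes that can reach $w$ in $K'_w$. $D$ has node set $B(G_\tau)$, an arc $vw$ for distinct base nodes with $v\in\Pi(J_w)$, and a self-loop $ww$ whenever $w$ has an outgoing arc in $J_w$. For $j=\pi(w)/2$ and $0\le i<|\mathcal{C}^k_j|$, let $\nu_0:V(J_w)\to\bar L(T^k_{i,j})$ be $\nu_0(w)=\min L(T^k_{i,j})$, $\nu_0(u)=\top$ otherwise, and let $\lambda^k_{i,w}$ be the pointwise greatest labeling $\lambda\le\nu_0$ into $\bar L(T^k_{i,j})$ such that no arc of $J_w$ is loose w.r.t. $\lambda$. For an arc $vw$ of $D$: $\underline{c}^k(vw):=\min\{i:\lambda^k_{i,w}(u)\ne\top\text{ for some }u\in N^+_{J_w}(v)\}$ and $\overline{c}^k(vw):=\min\{\alpha^k(P):P\text{ a }u\text{ - }w\text{ path in }J_w,\ u\in N^+_{J_w}(v)\}$, with $\min\emptyset=\infty$. -}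

module Defs where

open import Level using (Level)
open import Data.Nat using (ℕ; zero; suc; _∸_; _≤_; _<_; ⌈_/2⌉; ⌊_/2⌋)
open import Data.Nat.Divisibility using (_∣_)
open import Data.Fin using (Fin)
open import Data.List using (List; []; _∷_; _++_; length; take; [_])
open import Data.List.Membership.Propositional using (_∈_)
open import Data.List.Relation.Unary.Unique.Propositional using (Unique)
open import Data.List.Relation.Unary.AllPairs using (AllPairs)
open import Data.Maybe using (Maybe; just; nothing)
open import Data.Product using (Σ; ∃; ∃-syntax; _×_; _,_; proj₁)
open import Data.Sum using (_⊎_)
open import Data.Unit using (⊤)
open import Relation.Nullary using (¬_)
open import Relation.Binary.PropositionalEquality using (_≡_; _≢_)
open import Relation.Binary.Construct.Closure.ReflexiveTransitive using (Star)
open import Function.Bundles using (_⇔_)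

-- extended naturals (∞ = "no such index"), with its order
data ℕ∞ : Set where
  fin : ℕ → ℕ∞
  ∞   : ℕ∞

data _≤∞_ : ℕ∞ → ℕ∞ → Set where
  fin≤fin : ∀ {a b} → a ≤ b → fin a ≤∞ fin b
  any≤∞   : ∀ {x} → x ≤∞ ∞

MinOf : {ℓ : Level} → (ℕ → Set ℓ) → ℕ∞ → Set ℓ
MinOf S (fin i) = S i × (∀ j → j < i → ¬ S j)
MinOf S ∞       = ∀ i → ¬ S i

data At {a : Level} {A : Set a} : List A → ℕ → A → Set a where
  at-here  : ∀ {x xs} → At (x ∷ xs) zero x
  at-there : ∀ {x y xs i} → At xs i y → At (x ∷ xs) (suc i) y

data Consec {A : Set} : List A → A → A → Set where
  consec-here  : ∀ {a b xs} → Consec (a ∷ b ∷ xs) a b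
  consec-there : ∀ {x a b xs} → Consec xs a b → Consec (x ∷ xs) a b

data IsPath {A : Set} (R : A → A → Set) : A → A → List A → Set where
  path-nil  : ∀ {u} → IsPath R u u (u ∷ [])
  path-cons : ∀ {u x w ps} → R u x → IsPath R x w ps → IsPath R u w (u ∷ ps)

-- Ordered trees: prefix-closed finite sets of tuples over ℕ,
-- tuples written root-first, i.e. ξ = (ξ_{2h-1}, …, ξ_1) as a list.

TreePred : Set₁
TreePred = List ℕ → Set

data _<ˡ_ : List ℕ → List ℕ → Set where
  []<∷  : ∀ {y ys} → [] <ˡ (y ∷ ys)
  head< : ∀ {x y xs ys} → x < y → (x ∷ xs) <ˡ (y ∷ ys)
  tail< : ∀ {x xs ys} → xs <ˡ ys → (x ∷ xs) <ˡ (x ∷ ys)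

_≤ˡ_ : List ℕ → List ℕ → Set
xs ≤ˡ ys = xs <ˡ ys ⊎ xs ≡ ys

IsLeafOf : TreePred → List ℕ → Set
IsLeafOf t x = t x × (∀ c → ¬ t (x ++ [ c ]))

record IsOrderedTree (h : ℕ) (t : TreePred) : Set where
  field
    root          : t []
    prefix-closed : ∀ x y → t (x ++ y) → t x
    finite        : ∃ λ (xs : List (List ℕ)) → ∀ x → t x → x ∈ xs
    leaves-depth  : ∀ x → IsLeafOf t x → length x ≡ h

record Tree (h : ℕ) : Set₁ where
  field
    mem    : TreePred
    isTree : IsOrderedTree h mem
open Tree public

_⊑_ : TreePred → TreePred → Set
s ⊑ t = ∃ λ (f : List ℕ → List ℕ) →
    (∀ x → s x → t (f x))
  × (∀ x y → s x → s y → f x ≡ f y → x ≡ y)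
  × (∀ x c → s x → s (x ++ [ c ]) → ∃ λ c' → f (x ++ [ c ]) ≡ f x ++ [ c' ])
  × (∀ x y → s x → s y → x <ˡ y → f x <ˡ f y)
  × (∀ x → IsLeafOf s x → IsLeafOf t (f x))

_≡ₜ_ : TreePred → TreePred → Set
s ≡ₜ t = (s ⊑ t) × (t ⊑ s)

_⊏_ : TreePred → TreePred → Set
s ⊏ t = (s ⊑ t) × ¬ (t ⊑ s)

AtMostLeaves : ℕ → TreePred → Set
AtMostLeaves ℓ t = ∃ λ (ls : List (List ℕ)) → length ls ≤ ℓ × (∀ x → IsLeafOf t x → x ∈ ls)

IsUniversal : (ℓ h : ℕ) → Tree h → Set₁
IsUniversal ℓ h T = ∀ (S : Tree h) → AtMostLeaves ℓ (mem S) → mem S ⊑ mem T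

SubAt : TreePred → List ℕ → TreePred
SubAt t x y = t (x ++ y)

record Representatives {h : ℕ} (T : Tree h) : Set₁ where
  field
    𝒯        : (j : ℕ) → List (Tree j)
    subtree  : ∀ j → j ≤ h → ∀ S → S ∈ 𝒯 j →
                 ∃ λ x → mem T x × length x ≡ h ∸ j × (∀ y → mem S y ⇔ SubAt (mem T) x y)
    distinct : ∀ j → j ≤ h → AllPairs (λ S S' → ¬ (mem S ≡ₜ mem S')) (𝒯 j)
    complete : ∀ j → j ≤ h → ∀ x → mem T x → length x ≡ h ∸ j →
                 ∃ λ S → S ∈ 𝒯 j × (mem S ≡ₜ SubAt (mem T) x)
open Representatives public

-- a cover 𝒞 = (𝒞_0,…,𝒞_h); 𝒞_j is a list of chains 𝒞^k_j = (T^k_{0,j} ⊏ T^k_{1,j} ⊏ …)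
record Cover {h : ℕ} (T : Tree h) (R : Representatives T) : Set₁ where
  field
    C         : (j : ℕ) → List (List (Tree j))
    chain-in  : ∀ j → j ≤ h → ∀ ch → ch ∈ C j → ∀ S → S ∈ ch → S ∈ 𝒯 R j
    chain-inc : ∀ j → j ≤ h → ∀ ch → ch ∈ C j → ∀ i S S' →
                  At ch i S → At ch (suc i) S' → mem S ⊏ mem S'
    covers    : ∀ j → j ≤ h → ∀ S → S ∈ 𝒯 R j → ∃ λ ch → ch ∈ C j × S ∈ ch
open Cover public

-- Labels: values in L̄(S) = L(S) ∪ {⊤}; nothing plays the role of ⊤.

Label : Set
Label = Maybe (List ℕ)

-- ξ|_p : delete the components of index < p (the last ⌊p/2⌋ ones)
trunc : ℕ → Label → Label
trunc p nothing  = nothing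
trunc p (just ξ) = just (take (length ξ ∸ ⌊ p /2⌋) ξ)

data _<̄_ : Label → Label → Set where
  just<just : ∀ {x y} → x <ˡ y → just x <̄ just y
  just<⊤    : ∀ {x} → just x <̄ nothing

_≤̄_ : Label → Label → Set
x ≤̄ y = x <̄ y ⊎ x ≡ y

Even : ℕ → Set
Even p = 2 ∣ p

-- NV p x y : the arc vw with π(v) = p, ν(v) = x, ν(w) = y is non-violated
NV : ℕ → Label → Label → Set
NV p x y = (Even p × trunc p y ≤̄ trunc p x)
         ⊎ (¬ Even p × (trunc p y <̄ trunc p x ⊎ (x ≡ nothing × y ≡ nothing)))

InBar : {h : ℕ} → Tree h → Label → Set
InBar S nothing  = ⊤
InBar S (just ξ) = IsLeafOf (mem S) ξ

Tight : {h : ℕ} → Tree h → ℕ → Label → Label → Set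
Tight S p x y = NV p x y × (∀ z → InBar S z → z <̄ x → ¬ NV p z y)

Loose : {h : ℕ} → Tree h → ℕ → Label → Label → Set
Loose S p x y = NV p x y × ¬ Tight S p x y

IsMinLeaf : {h : ℕ} → Tree h → List ℕ → Set
IsMinLeaf S ξ = IsLeafOf (mem S) ξ × (∀ ξ' → IsLeafOf (mem S) ξ' → ξ ≤ˡ ξ')

data Player : Set where
  even odd : Player

record ParityGame : Set₁ where
  field
    n       : ℕ
    d       : ℕ
    E       : Fin n → Fin n → Set
    owner   : Fin n → Player
    π       : Fin n → ℕ
    d-even  : Even d
    π-range : ∀ v → 1 ≤ π v × π v ≤ d
    total   : ∀ v → ∃ λ w → E v w

record Subgraph (N : ℕ) : Set₁ where
  field
    node : Fin N → Set
    arc  : Fin N → Fin N → Set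
open Subgraph public

PathSub : {N : ℕ} → List (Fin N) → Subgraph N
PathSub ps = record { node = λ x → x ∈ ps ; arc = Consec ps }

module _ (G : ParityGame) where
  open ParityGame G

  -- strategy for Odd (values on V₀ are irrelevant)
  OddStrategy : Set
  OddStrategy = Σ (Fin n → Fin n) λ τ → ∀ v → owner v ≡ odd → E v (τ v)

  Dominates : Subgraph n → Fin n → Set
  Dominates H x = node H x × (∀ u → node H u → π u ≤ π x)

  MaxPri : Subgraph n → ℕ → Set
  MaxPri H p = ∃ λ x → Dominates H x × π x ≡ p

  Feasible : Subgraph n → (Fin n → Label) → Set
  Feasible H ν = ∃ λ (σ : Fin n → Fin n) →
      (∀ v → owner v ≡ even → E v (σ v))
    × (∀ v → owner v ≡ even → (∃ λ u → arc H v u) → arc H v (σ v))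
    × (∀ a b → arc H a b → (owner a ≡ odd ⊎ b ≡ σ a) → NV (π a) (ν a) (ν b))

  IntoFin : {j : ℕ} → Subgraph n → Tree j → (Fin n → Label) → Set
  IntoFin H S ν = ∀ u → node H u → ∃ λ ξ → ν u ≡ just ξ × IsLeafOf (mem S) ξ

  IntoBar : {j : ℕ} → Subgraph n → Tree j → (Fin n → Label) → Set
  IntoBar H S ν = ∀ u → node H u → InBar S (ν u)

  NoLoose : {j : ℕ} → Subgraph n → Tree j → (Fin n → Label) → Set
  NoLoose H S ν = ∀ a b → arc H a b → ¬ Loose S (π a) (ν a) (ν b)

  module _ {h : ℕ} {T : Tree h} {R : Representatives T} (Cv : Cover T R) where
    FeasibleAt : ℕ → Subgraph n → ℕ → Set₁
    FeasibleAt k H i = ∃ λ p → MaxPri H p × ∃ λ ch → At (C Cv ⌈ p /2⌉) k ch ×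
      ∃ λ S → At ch i S × ∃ λ ν → IntoFin H S ν × Feasible H ν

    Width : ℕ → Subgraph n → ℕ∞ → Set₁
    Width k H a = MinOf (FeasibleAt k H) a

  module _ (τ : OddStrategy) where
    Eτ : Fin n → Fin n → Set
    Eτ v w = (owner v ≡ even × E v w) ⊎ (owner v ≡ odd × w ≡ proj₁ τ v)

    Base : Fin n → Set
    Base v = ∃ λ u → ∃ λ x → ∃ λ ps →
      IsPath Eτ u x ps × Eτ x u × Unique ps ×
      Dominates (PathSub ps) v × Even (π v)

    KNode : Fin n → Fin n → Set
    KNode w u = π u ≤ π w × Star R u w × Star R w u
      where
        R : Fin n → Fin n → Set
        R a b = Eτ a b × π a ≤ π w × π b ≤ π w

    K : Fin n → Subgraph n
    K w = record
      { node = KNode w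
      ; arc  = λ a b → Eτ a b × KNode w a × KNode w b }

    K' : Fin n → Subgraph n
    K' w = record
      { node = node (K w)
      ; arc  = λ a b → arc (K w) a b × ¬ (Dominates (K w) b × b ≢ w) }

    JNode : Fin n → Fin n → Set
    JNode w u = node (K w) u × Star (arc (K' w)) u w

    J : Fin n → Subgraph n
    J w = record
      { node = JNode w
      ; arc  = λ a b → arc (K' w) a b × JNode w a × JNode w b }

    DArc : Fin n → Fin n → Set
    DArc v w = Base v × Base w ×
      ((v ≢ w × Dominates (J w) v) ⊎ (v ≡ w × ∃ λ u → arc (J w) w u))

    IsLambda : {j : ℕ} → Fin n → Tree j → (Fin n → Label) → Set
    IsLambda w S λ' =
        IntoBar (J w) S λ' × BelowNu0 λ' × NoLoose (J w) S λ'
      × (∀ μ → IntoBar (J w) S μ → BelowNu0 μ → NoLoose (J w) S μ →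
           ∀ u → node (J w) u → μ u ≤̄ λ' u)
      where
        BelowNu0 : (Fin n → Label) → Set
        BelowNu0 μ = ∀ ξ → IsMinLeaf S ξ → μ w ≤̄ just ξ

    module _ {h : ℕ} {T : Tree h} {R : Representatives T} (Cv : Cover T R) where
      LowerC : (v w : Fin n) → List (Tree ⌊ π w /2⌋) → (ℕ → Fin n → Label) → ℕ∞ → Set₁
      LowerC v w ch lam a = MinOf
        (λ i → (∃ λ S → At ch i S) × ∃ λ u → arc (J w) v u × lam i u ≢ nothing) a

      UpperC : ℕ → (v w : Fin n) → ℕ∞ → Set₁
      UpperC k v w b = MinOf
        (λ x → ∃ λ u → arc (J w) v u × ∃ λ ps →
           IsPath (arc (J w)) u w ps × Unique ps × Width Cv k (PathSub ps) (fin x)) b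

-- A labeling κ without loose arcs stays below a feasible finite labeling ν along any path
-- whose endpoint satisfies κ ≤ ν: walking back along the path, if ν(u) < κ(u) then ν(u)
-- already makes the arc out of u non-violated against κ, so κ(u) is not tight and the arc
-- is loose.  Now λ^k_{i,w} has no loose arcs and λ^k_{i,w}(w) ≤ min L(T^k_{i,j}) ≤ ν(w), so if
-- a u–w path P of J_w with u ∈ N⁺(v) has α^k(P) = i, then λ^k_{i,w}(u) ≠ ⊤ and c̲^k(vw) ≤ i.
module Submission where

open import Defs
open import Data.Nat using (ℕ; zero; suc; _∸_; _*_; ⌊_/2⌋; ⌈_/2⌉; _≤?_)
open import Data.Nat.Divisibility using (divides)
open import Data.Nat.Properties using (<-cmp; <-trans; ≤-refl; ≤-antisym; ≰⇒>)
open import Data.Fin using (Fin)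
open import Data.List using (List; []; _∷_; take; length)
open import Data.List.Membership.Propositional using (_∈_)
open import Data.List.Relation.Unary.Any using (here; there)
open import Data.List.Relation.Unary.AllPairs using (_∷_)
import Data.List.Relation.Unary.All as All
open import Data.List.Relation.Unary.Unique.Propositional using (Unique)
open import Data.Maybe using (just; nothing)
open import Data.Product using (Σ; ∃; _×_; _,_; proj₁)
open import Data.Sum using (_⊎_; inj₁; inj₂; [_,_]′)
open import Data.Unit using (⊤; tt)
open import Data.Empty using (⊥-elim)
open import Relation.Nullary using (¬_; yes; no)
open import Relation.Nullary.Decidable using (¬¬-excluded-middle)
open import Relation.Binary.Definitions using (tri<; tri≈; tri>)
open import Relation.Binary.PropositionalEquality
  using (_≡_; _≢_; refl; sym; trans; cong; subst; subst₂)
open import Relation.Binary.Construct.Closure.ReflexiveTransitive using (ε)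

<ˡ-trans : ∀ {xs ys zs} → xs <ˡ ys → ys <ˡ zs → xs <ˡ zs
<ˡ-trans []<∷       (head< _) = []<∷
<ˡ-trans []<∷       (tail< _) = []<∷
<ˡ-trans (head< p) (head< q) = head< (<-trans p q)
<ˡ-trans (head< p) (tail< _) = head< p
<ˡ-trans (tail< _) (head< q) = head< q
<ˡ-trans (tail< p) (tail< q) = tail< (<ˡ-trans p q)

≤ˡ-trans : ∀ {xs ys zs} → xs ≤ˡ ys → ys ≤ˡ zs → xs ≤ˡ zs
≤ˡ-trans (inj₁ p)    (inj₁ q)    = inj₁ (<ˡ-trans p q)
≤ˡ-trans (inj₁ p)    (inj₂ refl) = inj₁ p
≤ˡ-trans (inj₂ refl) q           = q

<ˡ-trichotomous : ∀ xs ys → xs <ˡ ys ⊎ xs ≡ ys ⊎ ys <ˡ xs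
<ˡ-trichotomous []       []       = inj₂ (inj₁ refl)
<ˡ-trichotomous []       (_ ∷ _)  = inj₁ []<∷
<ˡ-trichotomous (_ ∷ _)  []       = inj₂ (inj₂ []<∷)
<ˡ-trichotomous (x ∷ xs) (y ∷ ys) with <-cmp x y
... | tri< x<y _ _ = inj₁ (head< x<y)
... | tri> _ _ y<x = inj₂ (inj₂ (head< y<x))
... | tri≈ _ refl _ with <ˡ-trichotomous xs ys
...   | inj₁ p         = inj₁ (tail< p)
...   | inj₂ (inj₁ refl) = inj₂ (inj₁ refl)
...   | inj₂ (inj₂ p)  = inj₂ (inj₂ (tail< p))

take-mono-<ˡ : ∀ k {xs ys} → xs <ˡ ys → take k xs ≤ˡ take k ys
take-mono-<ˡ zero    _         = inj₂ refl
take-mono-<ˡ (suc k) []<∷      = inj₁ []<∷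
take-mono-<ˡ (suc k) (head< p) = inj₁ (head< p)
take-mono-<ˡ (suc k) (tail< {x} p) with take-mono-<ˡ k p
... | inj₁ q = inj₁ (tail< q)
... | inj₂ q = inj₂ (cong (x ∷_) q)

<̄-trans : ∀ {x y z} → x <̄ y → y <̄ z → x <̄ z
<̄-trans (just<just p) (just<just q) = just<just (<ˡ-trans p q)
<̄-trans (just<just _) just<⊤        = just<⊤

≤̄-trans : ∀ {x y z} → x ≤̄ y → y ≤̄ z → x ≤̄ z
≤̄-trans (inj₁ p)    (inj₁ q)    = inj₁ (<̄-trans p q)
≤̄-trans (inj₁ p)    (inj₂ refl) = inj₁ p
≤̄-trans (inj₂ refl) q           = q

≤-<̄-trans : ∀ {x y z} → x ≤̄ y → y <̄ z → x <̄ z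
≤-<̄-trans (inj₁ p)    q = <̄-trans p q
≤-<̄-trans (inj₂ refl) q = q

<-≤̄-trans : ∀ {x y z} → x <̄ y → y ≤̄ z → x <̄ z
<-≤̄-trans p (inj₁ q)    = <̄-trans p q
<-≤̄-trans p (inj₂ refl) = p

<̄-trichotomous : ∀ x y → x <̄ y ⊎ x ≡ y ⊎ y <̄ x
<̄-trichotomous nothing  nothing  = inj₂ (inj₁ refl)
<̄-trichotomous nothing  (just _) = inj₂ (inj₂ just<⊤)
<̄-trichotomous (just _) nothing  = inj₁ just<⊤
<̄-trichotomous (just x) (just y) with <ˡ-trichotomous x y
... | inj₁ p           = inj₁ (just<just p)
... | inj₂ (inj₁ refl) = inj₂ (inj₁ refl)
... | inj₂ (inj₂ p)    = inj₂ (inj₂ (just<just p))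

just-mono-≤ : ∀ {xs ys} → xs ≤ˡ ys → just xs ≤̄ just ys
just-mono-≤ (inj₁ p) = inj₁ (just<just p)
just-mono-≤ (inj₂ p) = inj₂ (cong just p)

⊤≰̄just : ∀ {ξ} → ¬ (nothing ≤̄ just ξ)
⊤≰̄just (inj₁ ())
⊤≰̄just (inj₂ ())

-- Truncation is monotone only between tuples of equal length.
HasLength : ℕ → Label → Set
HasLength j nothing  = ⊤
HasLength j (just ξ) = length ξ ≡ j

InBar⇒HasLength : ∀ {j} (S : Tree j) {x} → InBar S x → HasLength j x
InBar⇒HasLength S {nothing} _    = tt
InBar⇒HasLength S {just ξ}  leaf = IsOrderedTree.leaves-depth (isTree S) ξ leaf

trunc-mono-≤̄ : ∀ {j} p {x y} → HasLength j x → HasLength j y → x ≤̄ y → trunc p x ≤̄ trunc p y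
trunc-mono-≤̄ p _ _ (inj₂ refl)   = inj₂ refl
trunc-mono-≤̄ p _ _ (inj₁ just<⊤) = inj₁ just<⊤
trunc-mono-≤̄ {j} p lx ly (inj₁ (just<just x<y)) rewrite lx | ly =
  just-mono-≤ (take-mono-<ˡ (j ∸ ⌊ p /2⌋) x<y)

NV-monoˡ : ∀ {j} p {ξ x y} → HasLength j (just ξ) → HasLength j x →
           just ξ ≤̄ x → NV p (just ξ) y → NV p x y
NV-monoˡ p lξ lx ξ≤x (inj₁ (ev , q))          = inj₁ (ev , ≤̄-trans q (trunc-mono-≤̄ p lξ lx ξ≤x))
NV-monoˡ p lξ lx ξ≤x (inj₂ (od , inj₁ q))     = inj₂ (od , inj₁ (<-≤̄-trans q (trunc-mono-≤̄ p lξ lx ξ≤x)))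
NV-monoˡ p lξ lx ξ≤x (inj₂ (od , inj₂ (() , _)))

NV-antiʳ : ∀ {j} p {ξ y y'} → HasLength j y' → HasLength j y →
           y' ≤̄ y → NV p (just ξ) y → NV p (just ξ) y'
NV-antiʳ p ly' ly y'≤y (inj₁ (ev , q))      = inj₁ (ev , ≤̄-trans (trunc-mono-≤̄ p ly' ly y'≤y) q)
NV-antiʳ p ly' ly y'≤y (inj₂ (od , inj₁ q)) = inj₂ (od , inj₁ (≤-<̄-trans (trunc-mono-≤̄ p ly' ly y'≤y) q))
NV-antiʳ p ly' ly y'≤y (inj₂ (od , inj₂ (() , _)))

-- If κ(v) exceeded a finite ν(v) that still makes the arc non-violated against κ(w),
-- then κ(v) would not be tight.
notLoose⇒≤ : ∀ {j} (S : Tree j) p {κv κw x y ξ} →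
  InBar S κv → InBar S κw → ¬ Loose S p κv κw →
  x ≡ just ξ → IsLeafOf (mem S) ξ → HasLength j y → NV p x y → κw ≤̄ y → κv ≤̄ x
notLoose⇒≤ S p {κv} {ξ = ξ} inκv inκw notLoose refl leaf ly nv κw≤y
  with <̄-trichotomous (just ξ) κv
... | inj₂ (inj₂ κv<ξ) = inj₁ κv<ξ
... | inj₂ (inj₁ ξ≡κv) = inj₂ (sym ξ≡κv)
... | inj₁ ξ<κv = ⊥-elim (notLoose (NV-monoˡ p lξ lκv (inj₁ ξ<κv) nvκw , notTight))
  where
  lξ : HasLength _ (just ξ)
  lξ = InBar⇒HasLength S {just ξ} leaf
  lκv : HasLength _ κv
  lκv = InBar⇒HasLength S inκv
  nvκw : NV p (just ξ) _
  nvκw = NV-antiʳ p (InBar⇒HasLength S inκw) ly κw≤y nv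
  notTight : ¬ Tight S p κv _
  notTight (_ , least) = least (just ξ) leaf ξ<κv nvκw

Consec-mem : ∀ {A : Set} {xs : List A} {a b} → Consec xs a b → a ∈ xs
Consec-mem consec-here      = here refl
Consec-mem (consec-there c) = there (Consec-mem c)

Consec-unique : ∀ {A : Set} {xs : List A} {a b c} → Unique xs → Consec xs a b → Consec xs a c → b ≡ c
Consec-unique _            consec-here      consec-here      = refl
Consec-unique (a∉ ∷ _)     consec-here      (consec-there c) = ⊥-elim (All.lookup a∉ (Consec-mem c) refl)
Consec-unique (a∉ ∷ _)     (consec-there c) consec-here      = ⊥-elim (All.lookup a∉ (Consec-mem c) refl)
Consec-unique (_ ∷ unique) (consec-there c) (consec-there c') = Consec-unique unique c c'

module _ {A : Set} {R : A → A → Set} where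

  IsPath-head : ∀ {u w ps} → IsPath R u w ps → u ∈ ps
  IsPath-head path-nil        = here refl
  IsPath-head (path-cons _ _) = here refl

  IsPath-last : ∀ {u w ps} → IsPath R u w ps → w ∈ ps
  IsPath-last path-nil        = here refl
  IsPath-last (path-cons _ p) = there (IsPath-last p)

  IsPath-Consec-head : ∀ {u x w ps} → IsPath R x w ps → Consec (u ∷ ps) u x
  IsPath-Consec-head path-nil        = consec-here
  IsPath-Consec-head (path-cons _ _) = consec-here

  notLoose-below-along-path : (π : A → ℕ) {j : ℕ} (S : Tree j) (κ ν : A → Label) →
    (∀ {a b} → R a b → InBar S (κ a) × InBar S (κ b) × ¬ Loose S (π a) (κ a) (κ b)) →
    ∀ {u w ps} → IsPath R u w ps →
    (∀ {a b} → Consec ps a b → NV (π a) (ν a) (ν b)) →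
    (∀ {a} → a ∈ ps → ∃ λ ξ → ν a ≡ just ξ × IsLeafOf (mem S) ξ) →
    κ w ≤̄ ν w → κ u ≤̄ ν u
  notLoose-below-along-path π S κ ν arcsOK path-nil nvν finν κw≤νw = κw≤νw
  notLoose-below-along-path π S κ ν arcsOK (path-cons {u} {x} r p) nvν finν κw≤νw
    with arcsOK r | finν (here refl) | finν (there (IsPath-head p))
  ... | inκu , inκx , notLoose | ξ , νu≡ξ , leaf | ξx , νx≡ξx , leafx =
    notLoose⇒≤ S (π u) inκu inκx notLoose νu≡ξ leaf lνx (nvν (IsPath-Consec-head p)) κx≤νx
    where
    lνx : HasLength _ (ν x)
    lνx = subst (HasLength _) (sym νx≡ξx) (InBar⇒HasLength S {just ξx} leafx)
    κx≤νx : κ x ≤̄ ν x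
    κx≤νx = notLoose-below-along-path π S κ ν arcsOK p
              (λ c → nvν (consec-there c)) (λ m → finν (there m)) κw≤νw

-- Membership in a tree is not decidable, so least leaves exist only up to double negation.

¬¬-least-among : (P : List ℕ → Set) (xs : List (List ℕ)) {ξ₀ : List ℕ} → P ξ₀ →
  ¬ ¬ (∃ λ ξ → P ξ × ∀ ξ' → ξ' ∈ xs → P ξ' → ξ ≤ˡ ξ')
¬¬-least-among P []       Pξ₀ k = k (_ , Pξ₀ , λ _ ())
¬¬-least-among P (y ∷ ys) Pξ₀ k = ¬¬-least-among P ys Pξ₀ λ { (ξ , Pξ , ξ-least) →
  ¬¬-excluded-middle λ
    { (no ¬Py) → k (ξ , Pξ , λ { _ (here refl) Py → ⊥-elim (¬Py Py)
                               ; ξ' (there m) Pξ' → ξ-least ξ' m Pξ' })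
    ; (yes Py) → k (least-of-two ξ Pξ ξ-least Py (<ˡ-trichotomous y ξ)) } }
  where
  least-of-two : ∀ ξ → P ξ → (∀ ξ' → ξ' ∈ ys → P ξ' → ξ ≤ˡ ξ') → P y →
    y <ˡ ξ ⊎ y ≡ ξ ⊎ ξ <ˡ y → ∃ λ ζ → P ζ × ∀ ξ' → ξ' ∈ y ∷ ys → P ξ' → ζ ≤ˡ ξ'
  least-of-two ξ Pξ ξ-least Py (inj₁ y<ξ) =
    y , Py , λ { _ (here refl) _ → inj₂ refl
               ; ξ' (there m) Pξ' → ≤ˡ-trans (inj₁ y<ξ) (ξ-least ξ' m Pξ') }
  least-of-two ξ Pξ ξ-least Py (inj₂ y≤ξ) =
    ξ , Pξ , λ { _ (here refl) _ → [ (λ y≡ξ → inj₂ (sym y≡ξ)) , inj₁ ]′ y≤ξ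
               ; ξ' (there m) Pξ' → ξ-least ξ' m Pξ' }

¬¬-minLeaf : ∀ {j} (S : Tree j) {ξ₀} → IsLeafOf (mem S) ξ₀ → ¬ ¬ (∃ (IsMinLeaf S))
¬¬-minLeaf S leaf k with IsOrderedTree.finite (isTree S)
... | nodes , complete = ¬¬-least-among (IsLeafOf (mem S)) nodes leaf λ
  { (ξ , leafξ , least) → k (ξ , leafξ , λ ξ' leaf' → least ξ' (complete ξ' (proj₁ leaf')) leaf') }

MinOf-≤ : ∀ {ℓ} {P : ℕ → Set ℓ} {a x} → MinOf P a → P x → a ≤∞ fin x
MinOf-≤ {a = ∞}     none    Px = ⊥-elim (none _ Px)
MinOf-≤ {a = fin i} {x} (_ , below) Px with i ≤? x
... | yes i≤x = fin≤fin i≤x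
... | no  i≰x = ⊥-elim (below x (≰⇒> i≰x) Px)

At-functional : ∀ {a} {A : Set a} {xs : List A} {i x y} → At xs i x → At xs i y → x ≡ y
At-functional at-here      at-here      = refl
At-functional (at-there p) (at-there q) = At-functional p q

chain-entry-transport : (F : (j : ℕ) → List (List (Tree j))) {j₁ j₂ : ℕ} → j₁ ≡ j₂ →
  ∀ {k i ch₁ ch₂ S₁} → At (F j₁) k ch₁ → At (F j₂) k ch₂ → At ch₁ i S₁ →
  Σ (Tree j₂) λ S₂ → At ch₂ i S₂ × mem S₂ ≡ mem S₁
chain-entry-transport F refl {S₁ = S₁} at₁ at₂ atS₁ with At-functional at₁ at₂
... | refl = S₁ , atS₁ , refl

⌈even/2⌉≡⌊even/2⌋ : ∀ m → Even m → ⌈ m /2⌉ ≡ ⌊ m /2⌋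
⌈even/2⌉≡⌊even/2⌋ m (divides q refl) = halves q
  where
  halves : ∀ q → ⌈ q * 2 /2⌉ ≡ ⌊ q * 2 /2⌋
  halves zero    = refl
  halves (suc q) = cong suc (halves q)

IntoFin-cong : (G : ParityGame) (H : Subgraph (ParityGame.n G)) {j₁ j₂ : ℕ}
  {S₁ : Tree j₁} {S₂ : Tree j₂} {ν : Fin (ParityGame.n G) → Label} →
  mem S₁ ≡ mem S₂ → IntoFin G H S₁ ν → IntoFin G H S₂ ν
IntoFin-cong G H S₁≡S₂ finite y y∈H with finite y y∈H
... | ξ , νy≡ξ , leaf = ξ , νy≡ξ , subst (λ t → IsLeafOf t ξ) S₁≡S₂ leaf

module _ (G : ParityGame) (τ : OddStrategy G) (w : Fin (ParityGame.n G)) where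
  open ParityGame G

  JPath : Fin n → List (Fin n) → Set
  JPath u ps = IsPath (arc (J G τ w)) u w ps

  JPath-nodes : ∀ {u ps y} → JPath u ps → y ∈ ps → JNode G τ w y
  JPath-nodes path-nil                 (here refl) = (≤-refl , ε , ε) , ε
  JPath-nodes (path-cons (_ , ju , _) _) (here refl) = ju
  JPath-nodes (path-cons _ p)            (there m)   = JPath-nodes p m

  JPath-maxPri : ∀ {u ps p} → JPath u ps → MaxPri G (PathSub ps) p → p ≡ π w
  JPath-maxPri path (y , (y∈ps , y-dominates) , refl) =
    ≤-antisym (proj₁ (proj₁ (JPath-nodes path y∈ps))) (y-dominates w (IsPath-last path))

  Feasible-on-path⇒NV : ∀ {ps ν} → Unique ps → Feasible G (PathSub ps) ν →
    ∀ {a b} → Consec ps a b → NV (π a) (ν a) (ν b)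
  Feasible-on-path⇒NV unique (σ , _ , σ-stays , nonViolated) {a} {b} c with owner a in owns
  ... | odd  = nonViolated a b c (inj₁ owns)
  ... | even = nonViolated a b c (inj₂ (Consec-unique unique c (σ-stays a owns (b , c))))

  IsLambda-finite-on-feasible-path : ∀ {j} {S : Tree j} {κ ν u ps} →
    IsLambda G τ w S κ → JPath u ps → Unique ps →
    IntoFin G (PathSub ps) S ν → Feasible G (PathSub ps) ν → κ u ≢ nothing
  IsLambda-finite-on-feasible-path {S = S} {κ} {ν} {u} (inBar , belowν₀ , noLoose , _)
    path unique finite feasible κu≡⊤
    with finite w (IsPath-last path) | finite u (IsPath-head path)
  ... | ξw , νw≡ξw , leafw | ξu , νu≡ξu , _ =
    ¬¬-minLeaf S leafw λ { (ξmin , isMin) →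
      ⊤≰̄just (subst₂ _≤̄_ κu≡⊤ νu≡ξu (κu≤νu ξmin isMin)) }
    where
    κu≤νu : ∀ ξmin → IsMinLeaf S ξmin → κ u ≤̄ ν u
    κu≤νu ξmin isMin@(_ , least) =
      notLoose-below-along-path π S κ ν
        (λ {a} {b} r → let (_ , ja , jb) = r in inBar a ja , inBar b jb , noLoose a b r)
        path (Feasible-on-path⇒NV unique feasible) (λ {a} m → finite a m)
        (≤̄-trans (belowν₀ ξmin isMin)
                  (subst (just ξmin ≤̄_) (sym νw≡ξw) (just-mono-≤ (least ξw leafw))))

lemma4p9 : (G : ParityGame) (τ : OddStrategy G)
           (T : Tree ⌊ ParityGame.d G /2⌋) →
           IsUniversal (ParityGame.n G) ⌊ ParityGame.d G /2⌋ T →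
           (R : Representatives T) (Cv : Cover T R) →
           (v w : Fin (ParityGame.n G)) → DArc G τ v w →
           (k : ℕ) (ch : List (Tree ⌊ ParityGame.π G w /2⌋)) →
           At (C Cv ⌊ ParityGame.π G w /2⌋) k ch →
           (lam : ℕ → Fin (ParityGame.n G) → Label) →
           (∀ i S → At ch i S → IsLambda G τ w S (lam i)) →
           (a b : ℕ∞) →
           LowerC G τ Cv v w ch lam a →
           UpperC G τ Cv k v w b →
           a ≤∞ b
lemma4p9 G τ T _ R Cv v w darc k ch atch lam isLambda a ∞ _ _ = any≤∞
lemma4p9 G τ T _ R Cv v w (_ , (_ , _ , _ , _ , _ , _ , _ , πw-even) , _) k ch atch lam isLambda
  a (fin x) lower ((u , vu , ps , path , unique , (p , maxPri , ch' , atch' , S' , atS' , ν , finite , feasible) , _) , _)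
  with chain-entry-transport (C Cv) sameLevel atch' atch atS'
  where
  sameLevel : ⌈ p /2⌉ ≡ ⌊ ParityGame.π G w /2⌋
  sameLevel = trans (cong ⌈_/2⌉ (JPath-maxPri G τ w path maxPri)) (⌈even/2⌉≡⌊even/2⌋ _ πw-even)
... | S , atS , memS≡memS' =
  MinOf-≤ lower ((S , atS) , u , vu , λ-finite)
  where
  λ-finite : lam x u ≢ nothing
  λ-finite = IsLambda-finite-on-feasible-path G τ w (isLambda x S atS) path unique
    (IntoFin-cong G (PathSub ps) {S₁ = S'} {S₂ = S} (sym memS≡memS') finite) feasible
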